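{- Let $m,n\ge 2$ be integers. If $\mathcal{K}_{m,n}$ admits a $C_4$-face-magic Klein bottle labeling, then $n$ is even.
   Context: For integers $m,n\ge 2$, the $m\times n$ Klein bottle grid graph $\mathcal{K}_{m,n}$ has vertex set $\{(i,j):1\le i\le m,\ 1\le j\le n\}$ and edges $(i,j)(i,j+1)$ for $1\le j\le n-1$; $(i,n)(i,1)$; $(i,j)(i+1,j)$ for $1\le i\le m-1$; and $(m,j)(1,n+1-j)$ for $1\le j\le n$. Its $4$-cycle faces in the natural Klein bottle embedding are, with column indices modulo $n$, $\{(i,j),(i,j+1),(i+1,j),(i+1,j+1)\}$ for $1\le i\le m-1$, $1\le j\le n$, and $\{(m,j),(m,j+1),(1,n+1-j),(1,n-j)\}$ for $1\le j\le n$. A $C_4$-face-magic Klein bottle labeling is a bijection $f$ from the vertices to $\{1,\dots,mn\}$ such that the sum of labels over every such $4$-cycle face is the same constant. -}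

module Defs where

open import Data.Nat using (ℕ; zero; suc; _+_; _*_; _∸_; _<_; NonZero)
open import Data.Nat.DivMod using (_%_; m%n<n)
open import Data.Fin using (Fin; toℕ; fromℕ<)
open import Data.Fin.Properties using ()
open import Data.Nat.Properties using (<-trans; n<1+n)
open import Data.Product using (_×_; _,_; Σ)
open import Function.Bundles using (_⤖_; Bijection)
open import Relation.Binary.PropositionalEquality using (_≡_)

-- Vertices of K_{m,n}, 0-indexed: (i , j) stands for the paper's (i+1 , j+1).
Vertex : ℕ → ℕ → Set
Vertex m n = Fin m × Fin n

col : (n : ℕ) → .{{NonZero n}} → ℕ → Fin n
col n k = fromℕ< (m%n<n k n)

-- label of a vertex given by natural-number coordinates (i < m, column mod n)
-- A labeling is a bijection L from vertices onto Fin (m * n); the paper's label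
-- of v is suc (toℕ (L v)) ∈ {1, …, m n}.
label : {m n : ℕ} .{{_ : NonZero n}} → (Vertex m n ⤖ Fin (m * n)) →
        Fin m → ℕ → ℕ
label {m} {n} L i k = suc (toℕ (Bijection.to L (i , col n k)))

-- Twisted faces: {(m,j),(m,j+1),(1,n+1-j),(1,n-j)}, 0-indexed:
--   {(m-1,j),(m-1,j+1),(0,n-1-j),(0,n-2-j)} with columns mod n.
record FaceMagic (m n : ℕ) .{{_ : NonZero n}} (L : Vertex m n ⤖ Fin (m * n)) (c : ℕ) : Set where
  field
    interior : (i : ℕ) (i<m : suc i < m) (j : Fin n) →
      let a = fromℕ< {i} (<-trans (n<1+n i) i<m)
          b = fromℕ< {suc i} i<m
          j′ = toℕ j
      in label L a j′ + label L a (suc j′) + label L b j′ + label L b (suc j′) ≡ c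
    twisted : (last first : Fin m) → toℕ last ≡ m ∸ 1 → toℕ first ≡ 0 → (j : Fin n) →
      let j′ = toℕ j
      in label L last j′ + label L last (suc j′)
         + label L first (n + n ∸ 1 ∸ j′) + label L first (n + n ∸ 2 ∸ j′) ≡ c

HasFaceMagicLabeling : (m n : ℕ) .{{_ : NonZero n}} → Set
HasFaceMagicLabeling m n =
  Σ (Vertex m n ⤖ Fin (m * n)) λ L → Σ ℕ λ c → FaceMagic m n L c

{-# OPTIONS --safe #-}
module Submission where

-- Let a, b be the last two rows and f the first. The interior faces between a and b give
-- s k + s (k+1) = c for the column sums s k = a_k + b_k, and the twisted faces give the same
-- relation for u k = b_k + f_{-1-k}. Both are relations around a cycle of length n; if n is
-- odd they force s 0 = c/2 = u 0, whence a_0 = f_{n-1}, contradicting injectivity since n ≥ 2.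

open import Defs
open import Data.Nat using (ℕ; _≤_; NonZero; zero; suc; _+_; _*_; _∸_; _<_; _%_; s≤s)
open import Data.Nat.Divisibility using (_∣_; divides)
open import Data.Nat.DivMod using (m%n<n; [m+n]%n≡m%n; m<n⇒m%n≡m)
open import Data.Nat.Properties
  using (+-suc; +-comm; +-assoc; +-identityʳ; *-comm; *-cancelˡ-≡; +-cancelˡ-≡;
         ∸-+-assoc; m+n∸n≡m; n<1+n; 0≢1+n; <-trans; <⇒≤; ≤-refl; suc-injective; +-commutativeSemigroup)
open import Algebra.Properties.CommutativeSemigroup +-commutativeSemigroup using (interchange)
open import Data.Fin using (Fin; toℕ; fromℕ<)
import Data.Fin as Fin
open import Data.Fin.Properties using (toℕ-fromℕ<; fromℕ<-cong; toℕ-injective)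
open import Data.Product using (_,_; proj₂; ∃-syntax)
open import Data.Sum using (_⊎_; inj₁; inj₂)
open import Function.Bundles using (_⤖_; Bijection)
open import Relation.Nullary using (contradiction)
open import Relation.Binary.PropositionalEquality
  using (_≡_; _≢_; refl; sym; trans; cong; cong₂; subst; module ≡-Reasoning)

even-or-odd : ∀ n → (∃[ t ] n ≡ t + t) ⊎ (∃[ t ] n ≡ suc (t + t))
even-or-odd zero = inj₁ (0 , refl)
even-or-odd (suc n) with even-or-odd n
... | inj₁ (t , n≡t+t) = inj₂ (t , cong suc n≡t+t)
... | inj₂ (t , n≡1+t+t) = inj₁ (suc t , cong suc (trans n≡1+t+t (sym (+-suc t t))))

m+m≡2*m : ∀ m → m + m ≡ 2 * m
m+m≡2*m m = cong (m +_) (sym (+-identityʳ m))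

2∣m+m : ∀ m → 2 ∣ m + m
2∣m+m m = divides m (trans (m+m≡2*m m) (*-comm 2 m))

m+m≡n+n⇒m≡n : ∀ {m n} → m + m ≡ n + n → m ≡ n
m+m≡n+n⇒m≡n {m} {n} eq = *-cancelˡ-≡ m n 2 (trans (sym (m+m≡2*m m)) (trans eq (m+m≡2*m n)))

[a+c]+[b+d]≡a+b+c+d : ∀ a b c d → (a + c) + (b + d) ≡ a + b + c + d
[a+c]+[b+d]≡a+b+c+d a b c d = trans (interchange a c b d) (sym (+-assoc (a + b) c d))

ConstantAdjacentSums : (ℕ → ℕ) → ℕ → ℕ → Set
ConstantAdjacentSums s c n = ∀ k → k < n → s k + s (suc k) ≡ c

module _ {s : ℕ → ℕ} {c n : ℕ} (adjacent : ConstantAdjacentSums s c n) where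

  two-periodic : ∀ k → suc k < n → s (suc (suc k)) ≡ s k
  two-periodic k 1+k<n = +-cancelˡ-≡ (s (suc k)) _ _ (begin
    s (suc k) + s (suc (suc k))  ≡⟨ adjacent (suc k) 1+k<n ⟩
    c                            ≡⟨ adjacent k (<⇒≤ 1+k<n) ⟨
    s k + s (suc k)              ≡⟨ +-comm (s k) (s (suc k)) ⟩
    s (suc k) + s k              ∎)
    where open ≡-Reasoning

  even-indices : ∀ i → i + i < n → s (i + i) ≡ s 0
  even-indices zero _ = refl
  even-indices (suc i) 2+2i<n = begin
    s (suc i + suc i)    ≡⟨ cong (λ j → s (suc j)) (+-suc i i) ⟩
    s (suc (suc (i + i))) ≡⟨ two-periodic (i + i) 1+2i<n ⟩
    s (i + i)            ≡⟨ even-indices i (<-trans (n<1+n (i + i)) 1+2i<n) ⟩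
    s 0                  ∎
    where
    open ≡-Reasoning
    1+2i<n : suc (i + i) < n
    1+2i<n = <-trans (n<1+n _) (subst (_< n) (cong suc (+-suc i i)) 2+2i<n)

odd-cycle-halves : ∀ {c n} (s : ℕ → ℕ) t → n ≡ suc (t + t) → ConstantAdjacentSums s c n →
                   s n ≡ s 0 → s 0 + s 0 ≡ c
odd-cycle-halves {c} s t refl adjacent periodic = begin
  s 0 + s 0                  ≡⟨ cong₂ _+_ (even-indices {s} {c} adjacent t (n<1+n (t + t))) periodic ⟨
  s (t + t) + s (suc (t + t)) ≡⟨ adjacent (t + t) ≤-refl ⟩
  c                          ∎
  where open ≡-Reasoning

n+n∸1≡n∸1+n : ∀ n → .{{NonZero n}} → n + n ∸ 1 ≡ n ∸ 1 + n
n+n∸1≡n∸1+n (suc _) = refl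

module Labels {m n : ℕ} .{{_ : NonZero n}} (L : Vertex m n ⤖ Fin (m * n)) where

  col-periodic : ∀ k → col n (k + n) ≡ col n k
  col-periodic k = fromℕ<-cong _ _ ([m+n]%n≡m%n k n) _ _

  label-periodic : ∀ i k → label L i (k + n) ≡ label L i k
  label-periodic i k = cong (λ j → suc (toℕ (Bijection.to L (i , j)))) (col-periodic k)

  label-injective : ∀ {i i′ k k′} → label L i k ≡ label L i′ k′ → col n k ≡ col n k′
  label-injective eq = cong proj₂ (Bijection.injective L (toℕ-injective (suc-injective eq)))

  reflected-label-periodic : ∀ i → label L i (n + n ∸ 1) ≡ label L i (n ∸ 1)
  reflected-label-periodic i = trans (cong (label L i) (n+n∸1≡n∸1+n n)) (label-periodic i (n ∸ 1))

first-col≢last-col : ∀ n → 2 ≤ n → .{{_ : NonZero n}} → col n 0 ≢ col n (n ∸ 1)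
first-col≢last-col (suc (suc k)) (s≤s (s≤s _)) eq = 0≢1+n (begin
  0                         ≡⟨ cong toℕ eq ⟩
  toℕ (col _ (suc k))       ≡⟨ toℕ-fromℕ< (m%n<n (suc k) (suc (suc k))) ⟩
  suc k % suc (suc k)       ≡⟨ m<n⇒m%n≡m (n<1+n (suc k)) ⟩
  suc k                     ∎)
  where open ≡-Reasoning

module FaceMagicCycles {m n : ℕ} .{{_ : NonZero n}} {L : Vertex m n ⤖ Fin (m * n)} {c : ℕ}
                       (magic : FaceMagic m n L c) where

  open FaceMagic magic
  open Labels L

  lower-row upper-row : (i : ℕ) → suc i < m → Fin m
  lower-row i i<m = fromℕ< (<-trans (n<1+n i) i<m)
  upper-row i i<m = fromℕ< i<m

  column-sum : (a b : Fin m) → ℕ → ℕ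
  column-sum a b k = label L a k + label L b k

  -- The twisted faces pair column k of the last row with column -1 - k of the first row;
  -- n + n ∸ 1 ∸ k represents -1 - k modulo n without truncation for k ≤ n.
  twisted-sum : (last first : Fin m) → ℕ → ℕ
  twisted-sum last first k = label L last k + label L first (n + n ∸ 1 ∸ k)

  interior-adjacent-sums : ∀ i (i<m : suc i < m) →
    ConstantAdjacentSums (column-sum (lower-row i i<m) (upper-row i i<m)) c n
  interior-adjacent-sums i i<m k k<n =
    trans ([a+c]+[b+d]≡a+b+c+d (ℓ a k) (ℓ a (suc k)) (ℓ b k) (ℓ b (suc k)))
          (subst (λ j → ℓ a j + ℓ a (suc j) + ℓ b j + ℓ b (suc j) ≡ c)
                 (toℕ-fromℕ< k<n) (interior i i<m (fromℕ< k<n)))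
    where
    ℓ : Fin m → ℕ → ℕ
    ℓ = label L
    a b : Fin m
    a = lower-row i i<m
    b = upper-row i i<m

  twisted-adjacent-sums : ∀ last first → toℕ last ≡ m ∸ 1 → toℕ first ≡ 0 →
    ConstantAdjacentSums (twisted-sum last first) c n
  twisted-adjacent-sums last first last≡m-1 first≡0 k k<n = begin
    twisted-sum last first k + twisted-sum last first (suc k)
      ≡⟨ [a+c]+[b+d]≡a+b+c+d (ℓ last k) (ℓ last (suc k)) (ℓ first (r k)) (ℓ first (r (suc k))) ⟩
    ℓ last k + ℓ last (suc k) + ℓ first (r k) + ℓ first (r (suc k))
      ≡⟨ cong (λ x → ℓ last k + ℓ last (suc k) + ℓ first (r k) + ℓ first x) r-suc ⟩
    ℓ last k + ℓ last (suc k) + ℓ first (r k) + ℓ first (n + n ∸ 2 ∸ k)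
      ≡⟨ subst (λ j → ℓ last j + ℓ last (suc j) + ℓ first (r j) + ℓ first (n + n ∸ 2 ∸ j) ≡ c)
               (toℕ-fromℕ< k<n) (twisted last first last≡m-1 first≡0 (fromℕ< k<n)) ⟩
    c ∎
    where
    open ≡-Reasoning
    ℓ : Fin m → ℕ → ℕ
    ℓ = label L
    r : ℕ → ℕ
    r j = n + n ∸ 1 ∸ j
    r-suc : r (suc k) ≡ n + n ∸ 2 ∸ k
    r-suc = trans (∸-+-assoc (n + n) 1 (suc k)) (sym (∸-+-assoc (n + n) 2 k))

  column-sum-periodic : ∀ a b → column-sum a b n ≡ column-sum a b 0
  column-sum-periodic a b = cong₂ _+_ (label-periodic a 0) (label-periodic b 0)

  twisted-sum-periodic : ∀ last first → twisted-sum last first n ≡ twisted-sum last first 0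
  twisted-sum-periodic last first =
    cong₂ _+_ (label-periodic last 0)
              (trans (cong (label L first) reflected-n) (sym (reflected-label-periodic first)))
    where
    reflected-n : n + n ∸ 1 ∸ n ≡ n ∸ 1
    reflected-n = trans (cong (_∸ n) (n+n∸1≡n∸1+n n)) (m+n∸n≡m (n ∸ 1) n)

proposition2p6 : (m n : ℕ) → 2 ≤ m → 2 ≤ n → .{{_ : NonZero n}} →
    HasFaceMagicLabeling m n → 2 ∣ n
proposition2p6 (suc (suc m)) n (s≤s (s≤s _)) 2≤n (L , c , magic) with even-or-odd n
... | inj₁ (t , n≡t+t) = subst (2 ∣_) (sym n≡t+t) (2∣m+m t)
... | inj₂ (t , n≡1+t+t) =
  contradiction (label-injective corner-labels-equal) (first-col≢last-col n 2≤n)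
  where
  open Labels L
  open FaceMagicCycles magic
  lower upper : Fin (suc (suc m))
  lower = lower-row m ≤-refl
  upper = upper-row m ≤-refl
  column≡twisted : column-sum lower upper 0 ≡ twisted-sum upper Fin.zero 0
  column≡twisted = m+m≡n+n⇒m≡n (trans
    (odd-cycle-halves (column-sum lower upper) t n≡1+t+t
      (interior-adjacent-sums m ≤-refl) (column-sum-periodic lower upper))
    (sym (odd-cycle-halves (twisted-sum upper Fin.zero) t n≡1+t+t
      (twisted-adjacent-sums upper Fin.zero (toℕ-fromℕ< ≤-refl) refl) (twisted-sum-periodic upper Fin.zero))))
  corner-labels-equal : label L lower 0 ≡ label L Fin.zero (n ∸ 1)
  corner-labels-equal = trans
    (+-cancelˡ-≡ (label L upper 0) _ _
      (trans (+-comm (label L upper 0) (label L lower 0)) column≡twisted))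
    (reflected-label-periodic Fin.zero)
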